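{- Let $n\ge1$, let $\lambda$ be a partition of an integer $t\le n$ with $l$ parts and $n_i$ parts equal to $i$ ($i\ge1$), let $j=n-t$, and let \[ \mu_\lambda(q)=\begin{bmatrix} n+l\\ n_1,n_2,\dots,n_n,n\end{bmatrix}_{q^2}. \] Let $d$ be an even positive divisor of $2n+2$ and $\zeta_d$ a primitive $d$-th root of unity. If $\mu_\lambda(\zeta_d)\neq 0$, then (1) $\frac d2$ divides $l$, (2) $\frac d2$ divides $n_i$ for every $i$, and (3) $d$ divides $2j+2$.
   Context: $[a]_q=1+q+\dots+q^{a-1}$, $[a]_q!=[1]_q\cdots[a]_q$, $\begin{bmatrix} N\\ a_1,\dots,a_r\end{bmatrix}_q=\frac{[N]_q!}{[a_1]_q!\cdots[a_r]_q!}$ for $\sum a_i=N$; the subscript $q^2$ means substituting $q^2$ for $q$. -}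

module Defs where

open import Level using (Level)
import Data.Nat as ℕ
open import Data.Nat using (ℕ; zero; suc; _∸_; _≤_; _≥_; _≟_)
open import Data.List using (List; []; _∷_; _++_; length; map; upTo; filter)
open import Data.List.Relation.Unary.All using (All)
open import Data.List.Relation.Unary.Linked using (Linked)
open import Data.Product using (_×_)
open import Data.Sum using (_⊎_)
open import Relation.Nullary using (¬_)
open import Relation.Binary.PropositionalEquality using (_≡_)
open import Algebra.Bundles using (CommutativeRing)

IsPartition : List ℕ → Set
IsPartition λs = All (λ p → 1 ≤ p) λs × Linked _≥_ λs

mult : ℕ → List ℕ → ℕ
mult i λs = length (filter (i ≟_) λs)

muEntries : ℕ → List ℕ → List ℕ
muEntries n λs = map (λ i → mult (suc i) λs) (upTo n) ++ (n ∷ [])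

module _ {c ℓ : Level} (R : CommutativeRing c ℓ) where
  open CommutativeRing R

  pow : Carrier → ℕ → Carrier
  pow x zero = 1#
  pow x (suc k) = x * pow x k

  embed : ℕ → Carrier
  embed zero = 0#
  embed (suc k) = 1# + embed k

  CharZero : Set ℓ
  CharZero = ∀ k → embed k ≈ 0# → k ≡ 0

  NoZeroDivisors : Set (c Level.⊔ ℓ)
  NoZeroDivisors = ∀ x y → x * y ≈ 0# → x ≈ 0# ⊎ y ≈ 0#

  PrimitiveRoot : ℕ → Carrier → Set ℓ
  PrimitiveRoot d ζ = pow ζ d ≈ 1# × (∀ k → 1 ≤ k → suc k ≤ d → ¬ (pow ζ k ≈ 1#))

  -- Gaussian binomial [N choose k]_q (a polynomial in ℤ[q]) evaluated at q = x,
  -- via the q-Pascal rule [N+1, k+1] = [N, k] + q^(k+1) [N, k+1].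
  qbinom : Carrier → ℕ → ℕ → Carrier
  qbinom x N zero = 1#
  qbinom x zero (suc k) = 0#
  qbinom x (suc N) (suc k) = qbinom x N k + pow x (suc k) * qbinom x N (suc k)

  -- q-multinomial [N ; a_1,…,a_r]_q evaluated at q = x (for Σ a_i = N),
  -- as the product [N, a_1]_q [N-a_1, a_2]_q ⋯
  qmultinom : Carrier → ℕ → List ℕ → Carrier
  qmultinom x N [] = 1#
  qmultinom x N (a ∷ as) = qbinom x N a * qmultinom x (N ∸ a) as

  mu : ℕ → List ℕ → Carrier → Carrier
  mu n λs ζ = qmultinom (ζ * ζ) (n ℕ.+ length λs) (muEntries n λs)

-- Put e = d/2. Then x = ζ² is a primitive e-th root of unity and μ_λ(ζ) is a product of Gaussian
-- binomials [a+b, a]_x. The two q-Pascal rules together give  u + x^(a+1) w = x^(b+1) u + w  for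
-- u = [a+b+1, a]_x and w = [a+b+1, a+1]_x, and induction on the residue of a modulo e turns this into
-- [a+b, a]_x = 0 whenever adding a and b modulo e carries (a q-Lucas phenomenon). In particular
-- [a+b, a]_x = 0 if e ∤ a but e ∣ b+1. Reading the multinomial [n+l; n_1, …, n_n, n]_x from the right,
-- where e ∣ n+1, every n_i must therefore be divisible by e; hence so are l = Σ n_i, t = Σ i·n_i and
-- (n+1) − t = j+1.
module Submission where

open import Defs
open import Level using (Level)
open import Algebra.Bundles using (CommutativeRing)
import Data.Nat as ℕ
import Data.Nat.Properties as ℕ
open import Data.Nat using (ℕ; zero; suc; 2+; _≤_; _<_; _/_; NonZero; s≤s; z≤n)
open import Data.Nat.DivMod using (_%_; m≡m%n+[m/n]*n; m%n<n; %-pred-≡0)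
open import Data.Nat.Divisibility using (_∣_; _∣?_; _∣0; ∣m∣n⇒∣m+n; n∣m⇒m%n≡0; m%n≡0⇒n∣m)
open import Data.Nat.ListAction using (sum)
open import Data.List using (List; []; _∷_; _++_)
open import Data.List.Relation.Unary.All using (All; []; _∷_)
open import Data.Product using (_×_; _,_; proj₁; proj₂)
open import Data.Sum using (inj₁; inj₂)
open import Function using (_∘_)
open import Relation.Nullary using (¬_; yes; no; contradiction)
open import Relation.Binary.PropositionalEquality as ≡ using (_≡_)

All∣⇒∣sum : ∀ {m ns} → All (m ∣_) ns → m ∣ sum ns
All∣⇒∣sum {m} []           = m ∣0
All∣⇒∣sum     (m∣n ∷ m∣ns) = ∣m∣n⇒∣m+n m∣n (All∣⇒∣sum m∣ns)

module _ {c ℓ : Level} (R : CommutativeRing c ℓ) where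

  open CommutativeRing R hiding (zero)
  open import Algebra.Properties.Ring ring using (x∙y⁻¹≈ε⇒x≈y; [y-z]x≈yx-zx; +-cancelˡ)
  open import Algebra.Solver.Ring.NaturalCoefficients.Default commutativeSemiring
    using (solve; _:=_; _:+_; _:*_; con)
  open import Relation.Binary.Reasoning.Setoid setoid

  private
    _^_ : Carrier → ℕ → Carrier
    x ^ n = pow R x n

  pow-+ : ∀ x m n → x ^ (m ℕ.+ n) ≈ x ^ m * x ^ n
  pow-+ x zero    n = sym (*-identityˡ (x ^ n))
  pow-+ x (suc m) n = trans (*-congˡ (pow-+ x m n)) (sym (*-assoc x (x ^ m) (x ^ n)))

  pow-periodic : ∀ {x e} → x ^ e ≈ 1# → ∀ q r → x ^ (q ℕ.* e ℕ.+ r) ≈ x ^ r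
  pow-periodic         xᵉ≈1 zero    r = refl
  pow-periodic {x} {e} xᵉ≈1 (suc q) r = begin
    x ^ (e ℕ.+ q ℕ.* e ℕ.+ r)    ≡⟨ ≡.cong (x ^_) (ℕ.+-assoc e (q ℕ.* e) r) ⟩
    x ^ (e ℕ.+ (q ℕ.* e ℕ.+ r))  ≈⟨ pow-+ x e (q ℕ.* e ℕ.+ r) ⟩
    x ^ e * x ^ (q ℕ.* e ℕ.+ r)  ≈⟨ *-cong xᵉ≈1 (pow-periodic xᵉ≈1 q r) ⟩
    1# * x ^ r                   ≈⟨ *-identityˡ (x ^ r) ⟩
    x ^ r                        ∎

  pow-square : ∀ x k → (x * x) ^ k ≈ x ^ (k ℕ.* 2)
  pow-square x zero    = refl
  pow-square x (suc k) = trans (*-congˡ (pow-square x k)) (*-assoc x x (x ^ (k ℕ.* 2)))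

  primitiveRoot-square : ∀ {e ζ} → PrimitiveRoot R (e ℕ.* 2) ζ → PrimitiveRoot R e (ζ * ζ)
  primitiveRoot-square {e} {ζ} (ζᵈ≈1 , minimal) =
    trans (pow-square ζ e) ζᵈ≈1 ,
    λ k 1≤k k<e ζ²ᵏ≈1 → minimal (k ℕ.* 2) (ℕ.≤-trans 1≤k (ℕ.m≤m*n k 2)) (ℕ.*-monoˡ-< 2 k<e)
                                (trans (sym (pow-square ζ k)) ζ²ᵏ≈1)

  y*w≈w⇒w≈0 : NoZeroDivisors R → ∀ {y w} → y ≉ 1# → y * w ≈ w → w ≈ 0#
  y*w≈w⇒w≈0 noZeroDivisors {y} {w} y≉1 y*w≈w with noZeroDivisors (y - 1#) w [y-1]*w≈0
    where
    [y-1]*w≈0 : (y - 1#) * w ≈ 0#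
    [y-1]*w≈0 = begin
      (y - 1#) * w    ≈⟨ [y-z]x≈yx-zx w y 1# ⟩
      y * w - 1# * w  ≈⟨ +-cong y*w≈w (-‿cong (*-identityˡ w)) ⟩
      w - w           ≈⟨ -‿inverseʳ w ⟩
      0#              ∎
  ... | inj₁ y-1≈0 = contradiction (x∙y⁻¹≈ε⇒x≈y y 1# y-1≈0) y≉1
  ... | inj₂ w≈0   = w≈0

  module QBinomial (x : Carrier) where

    k>N⇒qbinom≈0 : ∀ {N k} → N < k → qbinom R x N k ≈ 0#
    k>N⇒qbinom≈0 {zero}  {suc k} _         = refl
    k>N⇒qbinom≈0 {suc N} {suc k} (s≤s N<k) = begin
      qbinom R x N k + x ^ suc k * qbinom R x N (suc k)
        ≈⟨ +-cong (k>N⇒qbinom≈0 N<k) (*-congˡ (k>N⇒qbinom≈0 (ℕ.m<n⇒m<1+n N<k))) ⟩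
      0# + x ^ suc k * 0#  ≈⟨ +-identityˡ _ ⟩
      x ^ suc k * 0#       ≈⟨ zeroʳ _ ⟩
      0#                   ∎

    qbinom-diag : ∀ N → qbinom R x N N ≈ 1#
    qbinom-diag zero    = refl
    qbinom-diag (suc N) = begin
      qbinom R x N N + x ^ suc N * qbinom R x N (suc N)
        ≈⟨ +-cong (qbinom-diag N) (*-congˡ (k>N⇒qbinom≈0 (ℕ.n<1+n N))) ⟩
      1# + x ^ suc N * 0#  ≈⟨ +-congˡ (zeroʳ _) ⟩
      1# + 0#              ≈⟨ +-identityʳ 1# ⟩
      1#                   ∎

    -- [a+b, a]_x, indexed by the sizes of the two blocks so that the two q-Pascal rules are mirror images.
    qchoose : ℕ → ℕ → Carrier
    qchoose a b = qbinom R x (a ℕ.+ b) a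

    qchoose-zeroʳ : ∀ a → qchoose a 0 ≈ 1#
    qchoose-zeroʳ a = trans (reflexive (≡.cong (λ N → qbinom R x N a) (ℕ.+-identityʳ a))) (qbinom-diag a)

    qchoose-pascalˡ : ∀ a b → qchoose (suc a) (suc b) ≈ qchoose a (suc b) + x ^ suc a * qchoose (suc a) b
    qchoose-pascalˡ a b = +-congˡ (*-congˡ (reflexive (≡.cong (λ N → qbinom R x N (suc a)) (ℕ.+-suc a b))))

    qchoose-pascalʳ : ∀ a b → qchoose (suc a) (suc b) ≈ x ^ suc b * qchoose a (suc b) + qchoose (suc a) b
    qchoose-pascalʳ zero zero =
      solve 1 (λ y → con 1 :+ y :* (con 1 :+ y :* con 0) := y :* con 1 :+ (con 1 :+ y :* con 0)) refl (x ^ 1)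
    qchoose-pascalʳ zero (suc b) = begin
      qchoose 1 (2+ b)                   ≈⟨ qchoose-pascalˡ zero (suc b) ⟩
      1# + x ^ 1 * qchoose 1 (suc b)     ≈⟨ +-congˡ (*-congˡ (qchoose-pascalʳ zero b)) ⟩
      1# + x ^ 1 * (x ^ suc b * 1# + C)
        ≈⟨ solve 3 (λ x y C → con 1 :+ (x :* con 1) :* (y :* con 1 :+ C)
                              := (x :* y) :* con 1 :+ (con 1 :+ (x :* con 1) :* C))
                   refl x (x ^ suc b) C ⟩
      x ^ 2+ b * 1# + (1# + x ^ 1 * C)   ≈⟨ +-congˡ (sym (qchoose-pascalˡ zero b)) ⟩
      x ^ 2+ b * 1# + qchoose 1 (suc b)  ∎
      where
      C = qchoose 1 b
    qchoose-pascalʳ (suc a) zero = begin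
      qchoose (2+ a) 1                      ≈⟨ qchoose-pascalˡ (suc a) zero ⟩
      qchoose (suc a) 1 + x ^ 2+ a * O₂     ≈⟨ +-congʳ (qchoose-pascalʳ a zero) ⟩
      (x ^ 1 * C + O₁) + x ^ 2+ a * O₂      ≈⟨ +-congʳ (+-congˡ O₁≈O₂) ⟩
      (x ^ 1 * C + O₂) + x ^ 2+ a * O₂
        ≈⟨ solve 4 (λ x y C O → ((x :* con 1) :* C :+ O) :+ (x :* y) :* O := (x :* con 1) :* (C :+ y :* O) :+ O)
                   refl x (x ^ suc a) C O₂ ⟩
      x ^ 1 * (C + x ^ suc a * O₂) + O₂     ≈⟨ +-congʳ (*-congˡ (+-congˡ (*-congˡ (sym O₁≈O₂)))) ⟩
      x ^ 1 * (C + x ^ suc a * O₁) + O₂     ≈⟨ +-congʳ (*-congˡ (sym (qchoose-pascalˡ a zero))) ⟩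
      x ^ 1 * qchoose (suc a) 1 + O₂        ∎
      where
      C  = qchoose a 1
      O₁ = qchoose (suc a) 0
      O₂ = qchoose (2+ a) 0
      O₁≈O₂ : O₁ ≈ O₂
      O₁≈O₂ = trans (qchoose-zeroʳ (suc a)) (sym (qchoose-zeroʳ (2+ a)))
    qchoose-pascalʳ (suc a) (suc b) = begin
      qchoose (2+ a) (2+ b)                                 ≈⟨ qchoose-pascalˡ (suc a) (suc b) ⟩
      qchoose (suc a) (2+ b) + x ^ 2+ a * qchoose (2+ a) (suc b)
        ≈⟨ +-cong (qchoose-pascalʳ a (suc b)) (*-congˡ (qchoose-pascalʳ (suc a) b)) ⟩
      (x ^ 2+ b * A + M) + x ^ 2+ a * (x ^ suc b * M + B)
        ≈⟨ solve 6 (λ x y z A M B → ((x :* z) :* A :+ M) :+ (x :* y) :* (z :* M :+ B)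
                                    := (x :* z) :* (A :+ y :* M) :+ (M :+ (x :* y) :* B))
                   refl x (x ^ suc a) (x ^ suc b) A M B ⟩
      x ^ 2+ b * (A + x ^ suc a * M) + (M + x ^ 2+ a * B)
        ≈⟨ sym (+-cong (*-congˡ (qchoose-pascalˡ a (suc b))) (qchoose-pascalˡ (suc a) b)) ⟩
      x ^ 2+ b * qchoose (suc a) (2+ b) + qchoose (2+ a) (suc b)  ∎
      where
      A = qchoose a (2+ b)
      M = qchoose (suc a) (suc b)
      B = qchoose (2+ a) b

  module AtPrimitiveRoot (noZeroDivisors : NoZeroDivisors R) {e : ℕ} .{{_ : NonZero e}} {x : Carrier}
                         (x-primitive : PrimitiveRoot R e x) where

    open QBinomial x

    xᵉ≈1 : x ^ e ≈ 1#
    xᵉ≈1 = proj₁ x-primitive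

    qchoose-carry≈0 : ∀ qa qb {ra rb} → ra < e → rb < e → e ≤ ra ℕ.+ rb →
                      qchoose (qa ℕ.* e ℕ.+ ra) (qb ℕ.* e ℕ.+ rb) ≈ 0#
    qchoose-carry≈0 qa qb {zero}        _      rb<e e≤rb      = contradiction e≤rb (ℕ.<⇒≱ rb<e)
    qchoose-carry≈0 qa qb {suc ra} {rb} 1+ra<e rb<e e≤1+ra+rb = begin
      qchoose (qa ℕ.* e ℕ.+ suc ra) b  ≡⟨ ≡.cong (λ m → qchoose m b) 1+a≡qa*e+[1+ra] ⟨
      w                                ≈⟨ y*w≈w⇒w≈0 noZeroDivisors x^[1+a]≉1 x^[1+a]*w≈w ⟩
      0#                               ∎
      where
      a = qa ℕ.* e ℕ.+ ra
      b = qb ℕ.* e ℕ.+ rb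
      u = qchoose a (suc b)
      w = qchoose (suc a) b
      1+a≡qa*e+[1+ra] : suc a ≡ qa ℕ.* e ℕ.+ suc ra
      1+a≡qa*e+[1+ra] = ≡.sym (ℕ.+-suc (qa ℕ.* e) ra)
      1+b≡qb*e+[1+rb] : suc b ≡ qb ℕ.* e ℕ.+ suc rb
      1+b≡qb*e+[1+rb] = ≡.sym (ℕ.+-suc (qb ℕ.* e) rb)
      x^[1+a]≉1 : x ^ suc a ≉ 1#
      x^[1+a]≉1 x^[1+a]≈1 = proj₂ x-primitive (suc ra) (s≤s z≤n) 1+ra<e (begin
        x ^ suc ra                 ≈⟨ pow-periodic xᵉ≈1 qa (suc ra) ⟨
        x ^ (qa ℕ.* e ℕ.+ suc ra)  ≡⟨ ≡.cong (x ^_) 1+a≡qa*e+[1+ra] ⟨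
        x ^ suc a                  ≈⟨ x^[1+a]≈1 ⟩
        1#                         ∎)
      balance : u + x ^ suc a * w ≈ x ^ suc b * u + w
      balance = trans (sym (qchoose-pascalˡ a b)) (qchoose-pascalʳ a b)
      -- Either rb + 1 = e, so x^(b+1) = 1, or u = 0 by induction on ra; either way balance gives x^(a+1) w = w.
      x^[1+a]*w≈w : x ^ suc a * w ≈ w
      x^[1+a]*w≈w with ℕ.m≤n⇒m<n∨m≡n rb<e
      ... | inj₂ 1+rb≡e =
        +-cancelˡ u (x ^ suc a * w) w (trans balance (+-congʳ (trans (*-congʳ x^[1+b]≈1) (*-identityˡ u))))
        where
        x^[1+b]≈1 : x ^ suc b ≈ 1#
        x^[1+b]≈1 = begin
          x ^ suc b                  ≡⟨ ≡.cong (x ^_) 1+b≡qb*e+[1+rb] ⟩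
          x ^ (qb ℕ.* e ℕ.+ suc rb)  ≈⟨ pow-periodic xᵉ≈1 qb (suc rb) ⟩
          x ^ suc rb                 ≡⟨ ≡.cong (x ^_) 1+rb≡e ⟩
          x ^ e                      ≈⟨ xᵉ≈1 ⟩
          1#                         ∎
      ... | inj₁ 1+rb<e = begin
          x ^ suc a * w              ≈⟨ +-identityˡ _ ⟨
          0# + x ^ suc a * w         ≈⟨ +-congʳ u≈0 ⟨
          u + x ^ suc a * w          ≈⟨ balance ⟩
          x ^ suc b * u + w          ≈⟨ +-congʳ (trans (*-congˡ u≈0) (zeroʳ _)) ⟩
          0# + w                     ≈⟨ +-identityˡ w ⟩
          w                          ∎
        where
        u≈0 : u ≈ 0#
        u≈0 = trans (reflexive (≡.cong (qchoose a) 1+b≡qb*e+[1+rb]))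
                    (qchoose-carry≈0 qa qb (ℕ.<⇒≤ 1+ra<e) 1+rb<e
                                     (≡.subst (e ≤_) (≡.sym (ℕ.+-suc ra rb)) e≤1+ra+rb))

    qchoose≈0 : ∀ {a b} → ¬ e ∣ a → e ∣ suc b → qchoose a b ≈ 0#
    qchoose≈0 {a} {b} e∤a e∣1+b = begin
      qchoose a b                                              ≡⟨ ≡.cong₂ qchoose (divMod a) (divMod b) ⟩
      qchoose (a / e ℕ.* e ℕ.+ a % e) (b / e ℕ.* e ℕ.+ b % e)
        ≈⟨ qchoose-carry≈0 (a / e) (b / e) (m%n<n a e) (m%n<n b e) e≤a%e+b%e ⟩
      0#                                                       ∎
      where
      divMod : ∀ m → m ≡ m / e ℕ.* e ℕ.+ m % e
      divMod m = ≡.trans (m≡m%n+[m/n]*n m e) (ℕ.+-comm (m % e) _)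
      1≤a%e : 1 ≤ a % e
      1≤a%e = ℕ.n≢0⇒n>0 (e∤a ∘ m%n≡0⇒n∣m a e)
      b%e≡e∸1 : b % e ≡ e ℕ.∸ 1
      b%e≡e∸1 = %-pred-≡0 (n∣m⇒m%n≡0 (suc b) e e∣1+b)
      e≤a%e+b%e : e ≤ a % e ℕ.+ b % e
      e≤a%e+b%e = ℕ.≤-trans (ℕ.≤-reflexive (≡.sym (ℕ.m+[n∸m]≡n (ℕ.>-nonZero⁻¹ e))))
                            (ℕ.+-mono-≤ 1≤a%e (ℕ.≤-reflexive (≡.sym b%e≡e∸1)))

    qmultinom≉0⇒∣ : ∀ {n N} as → N ≡ sum as ℕ.+ n → e ∣ suc n →
                    qmultinom R x N (as ++ n ∷ []) ≉ 0# → All (e ∣_) as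
    qmultinom≉0⇒∣             []       _          _     _           = []
    qmultinom≉0⇒∣ {n} {N} (a ∷ as) N≡a+sum+n e∣1+n qmultinom≉0 = e∣a ∷ e∣as
      where
      N≡a+[sum+n] : N ≡ a ℕ.+ (sum as ℕ.+ n)
      N≡a+[sum+n] = ≡.trans N≡a+sum+n (ℕ.+-assoc a (sum as) n)
      N∸a≡sum+n : N ℕ.∸ a ≡ sum as ℕ.+ n
      N∸a≡sum+n = ≡.trans (≡.cong (ℕ._∸ a) N≡a+[sum+n]) (ℕ.m+n∸m≡n a (sum as ℕ.+ n))
      e∣as : All (e ∣_) as
      e∣as = qmultinom≉0⇒∣ as N∸a≡sum+n e∣1+n λ rest≈0 →
        qmultinom≉0 (trans (*-congˡ rest≈0) (zeroʳ _))
      e∣1+sum+n : e ∣ suc (sum as ℕ.+ n)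
      e∣1+sum+n = ≡.subst (e ∣_) (ℕ.+-suc (sum as) n) (∣m∣n⇒∣m+n (All∣⇒∣sum e∣as) e∣1+n)
      e∣a : e ∣ a
      e∣a with e ∣? a
      ... | yes e∣a = e∣a
      ... | no  e∤a = contradiction (trans (*-congʳ first≈0) (zeroˡ _)) qmultinom≉0
        where
        first≈0 : qbinom R x N a ≈ 0#
        first≈0 = trans (reflexive (≡.cong (λ m → qbinom R x m a) N≡a+[sum+n])) (qchoose≈0 e∤a e∣1+sum+n)

-- Opened only here because above, _+_ and _*_ are the ring operations.
open import Data.Nat using (_+_; _*_; _∸_; _<?_; >-nonZero)
open import Data.Nat.Properties
open import Data.Nat.Divisibility using (divides; ∣m+n∣m⇒∣n; ∣m⇒∣m*n; *-cancelʳ-∣; *-monoˡ-∣)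
open import Data.Nat.DivMod using (m*n/n≡m)
open import Data.List using (length; map; upTo; applyUpTo)
open import Data.List.Properties using (filter-accept; filter-reject; filter-none; map-upTo; map-id)
import Data.List.Relation.Unary.All as All
open import Data.List.Relation.Unary.All.Properties using (map⁻; applyUpTo⁻; applyUpTo⁺₂)
open import Algebra.Properties.CommutativeSemigroup +-commutativeSemigroup using (x∙yz≈y∙xz)
open ≡ using (_≢_; refl; sym; trans; cong; cong₂; subst)
open ≡.≡-Reasoning

mult-∷-≡ : ∀ p ps → mult p (p ∷ ps) ≡ suc (mult p ps)
mult-∷-≡ p ps = cong length (filter-accept (p ≟_) refl)

mult-∷-≢ : ∀ {i p} ps → i ≢ p → mult i (p ∷ ps) ≡ mult i ps
mult-∷-≢ {i} ps i≢p = cong length (filter-reject (i ≟_) i≢p)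

mult≡0 : ∀ {i ps} → All (i ≢_) ps → mult i ps ≡ 0
mult≡0 {i} i∉ps = cong length (filter-none (i ≟_) i∉ps)

sum-applyUpTo-cong : ∀ {f g : ℕ → ℕ} n → (∀ i → f i ≡ g i) → sum (applyUpTo f n) ≡ sum (applyUpTo g n)
sum-applyUpTo-cong zero    f≗g = refl
sum-applyUpTo-cong (suc n) f≗g = cong₂ _+_ (f≗g 0) (sum-applyUpTo-cong n (f≗g ∘ suc))

sum-applyUpTo-0 : ∀ n → sum (applyUpTo (λ _ → 0) n) ≡ 0
sum-applyUpTo-0 zero    = refl
sum-applyUpTo-0 (suc n) = sum-applyUpTo-0 n

sum-applyUpTo-increaseAt : ∀ {f g : ℕ → ℕ} {p n} c → p < n →
                           f p ≡ c + g p → (∀ i → i ≢ p → f i ≡ g i) →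
                           sum (applyUpTo f n) ≡ c + sum (applyUpTo g n)
sum-applyUpTo-increaseAt {f} {g} {zero} {suc n} c _ fp≡c+gp f≗g = begin
  f 0 + sum (applyUpTo (f ∘ suc) n)
    ≡⟨ cong₂ _+_ fp≡c+gp (sum-applyUpTo-cong n (λ i → f≗g (suc i) λ ())) ⟩
  c + g 0 + sum (applyUpTo (g ∘ suc) n)    ≡⟨ +-assoc c (g 0) _ ⟩
  c + (g 0 + sum (applyUpTo (g ∘ suc) n))  ∎
sum-applyUpTo-increaseAt {f} {g} {suc p} {suc n} c (s≤s p<n) fp≡c+gp f≗g = begin
  f 0 + sum (applyUpTo (f ∘ suc) n)
    ≡⟨ cong₂ _+_ (f≗g 0 λ ())
                 (sum-applyUpTo-increaseAt c p<n fp≡c+gp (λ i i≢p → f≗g (suc i) (i≢p ∘ suc-injective))) ⟩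
  g 0 + (c + sum (applyUpTo (g ∘ suc) n))  ≡⟨ x∙yz≈y∙xz (g 0) c _ ⟩
  c + (g 0 + sum (applyUpTo (g ∘ suc) n))  ∎

sum-map≡sum-mult : ∀ (w : ℕ → ℕ) {n ps} → All (_< n) ps →
                   sum (map w ps) ≡ sum (applyUpTo (λ i → mult i ps * w i) n)
sum-map≡sum-mult w {n} []                    = sym (sum-applyUpTo-0 n)
sum-map≡sum-mult w {n} {p ∷ ps} (p<n ∷ ps<n) = begin
  w p + sum (map w ps)                             ≡⟨ cong (w p +_) (sum-map≡sum-mult w ps<n) ⟩
  w p + sum (applyUpTo (λ i → mult i ps * w i) n)  ≡⟨ sum-applyUpTo-increaseAt (w p) p<n
                                                        (cong (_* w p) (mult-∷-≡ p ps))
                                                        (λ i i≢p → cong (_* w i) (mult-∷-≢ ps i≢p)) ⟨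
  sum (applyUpTo (λ i → mult i (p ∷ ps) * w i) n)  ∎

∣mult⇒∣sum-map : ∀ {e n ps} (w : ℕ → ℕ) → All (_< n) ps → (∀ i → e ∣ mult i ps) → e ∣ sum (map w ps)
∣mult⇒∣sum-map {e} {n} w ps<n e∣mult =
  subst (e ∣_) (sym (sum-map≡sum-mult w ps<n))
        (All∣⇒∣sum (applyUpTo⁺₂ _ n λ i → ∣m⇒∣m*n (w i) (e∣mult i)))

length≡sum-mult : ∀ {n ps} → All (1 ≤_) ps → All (_≤ n) ps →
                  length ps ≡ sum (map (λ i → mult (suc i) ps) (upTo n))
length≡sum-mult {n} {ps} ps≥1 ps≤n = begin
  length ps                                   ≡⟨ length≡sum-map-1 ps ⟩
  sum (map (λ _ → 1) ps)                      ≡⟨ sum-map≡sum-mult (λ _ → 1) (All.map s≤s ps≤n) ⟩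
  mult 0 ps * 1 + sum (applyUpTo (λ i → mult (suc i) ps * 1) n)
    ≡⟨ cong₂ _+_ (cong (_* 1) (mult≡0 (All.map <⇒≢ ps≥1))) (sum-applyUpTo-cong n (λ i → *-identityʳ _)) ⟩
  sum (applyUpTo (λ i → mult (suc i) ps) n)   ≡⟨ cong sum (map-upTo _ n) ⟨
  sum (map (λ i → mult (suc i) ps) (upTo n))  ∎
  where
  length≡sum-map-1 : ∀ xs → length xs ≡ sum (map (λ _ → 1) xs)
  length≡sum-map-1 []       = refl
  length≡sum-map-1 (_ ∷ xs) = cong suc (length≡sum-map-1 xs)

∣entries⇒∣mult : ∀ {e n ps} → All (1 ≤_) ps → All (_≤ n) ps →
                 All (e ∣_) (map (λ i → mult (suc i) ps) (upTo n)) → ∀ i → e ∣ mult i ps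
∣entries⇒∣mult {e} ps≥1 _ _ zero = subst (e ∣_) (sym (mult≡0 (All.map <⇒≢ ps≥1))) (e ∣0)
∣entries⇒∣mult {e} {n} _ ps≤n e∣entries (suc i) with i <? n
... | yes i<n = applyUpTo⁻ (λ i → i) n (map⁻ e∣entries) i<n
... | no  i≮n = subst (e ∣_) (sym (mult≡0 (All.map 1+i≢p ps≤n))) (e ∣0)
  where
  1+i≢p : ∀ {p} → p ≤ n → suc i ≢ p
  1+i≢p p≤n refl = i≮n p≤n

All≤sum : ∀ ps → All (_≤ sum ps) ps
All≤sum []       = []
All≤sum (p ∷ ps) = m≤m+n p (sum ps) ∷ All.map (λ q≤ → ≤-trans q≤ (m≤n+m (sum ps) p)) (All≤sum ps)

∣1+[n∸t] : ∀ {e n t} → t ≤ n → e ∣ suc n → e ∣ t → e ∣ suc (n ∸ t)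
∣1+[n∸t] {e} {n} {t} t≤n e∣1+n = ∣m+n∣m⇒∣n (subst (e ∣_) 1+n≡t+[1+n∸t] e∣1+n)
  where
  1+n≡t+[1+n∸t] : suc n ≡ t + suc (n ∸ t)
  1+n≡t+[1+n∸t] = sym (trans (+-suc t (n ∸ t)) (cong suc (m+[n∸m]≡n t≤n)))

2*n+2≡[1+n]*2 : ∀ n → 2 * n + 2 ≡ suc n * 2
2*n+2≡[1+n]*2 n = trans (+-comm (2 * n) 2) (cong (2 +_) (*-comm 2 n))

lemma6p2 : ∀ {c ℓ : Level} (R : CommutativeRing c ℓ)
             → CharZero R → NoZeroDivisors R
             → (n : ℕ) → 1 ≤ n
             → (λs : List ℕ) → IsPartition λs → sum λs ≤ n
             → (d : ℕ) → 1 ≤ d → 2 ∣ d → d ∣ 2 * n + 2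
             → (ζ : CommutativeRing.Carrier R) → PrimitiveRoot R d ζ
             → ¬ (CommutativeRing._≈_ R (mu R n λs ζ) (CommutativeRing.0# R))
             → (d / 2 ∣ length λs)
               × (∀ i → d / 2 ∣ mult i λs)
               × (d ∣ 2 * (n ∸ sum λs) + 2)
lemma6p2 R _ noZeroDivisors n _ λs (parts≥1 , _) t≤n .(e * 2) 1≤d (divides e refl) d∣2n+2 ζ ζ-primitive mu≉0 =
  subst (_∣ length λs) e≡d/2 e∣l ,
  (λ i → subst (_∣ mult i λs) e≡d/2 (e∣mult i)) ,
  subst (e * 2 ∣_) (sym (2*n+2≡[1+n]*2 (n ∸ sum λs))) (*-monoˡ-∣ 2 (∣1+[n∸t] t≤n e∣1+n e∣t))
  where
  instance
    e≢0 : NonZero e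
    e≢0 = m*n≢0⇒m≢0 e {{>-nonZero 1≤d}}
  open AtPrimitiveRoot R noZeroDivisors (primitiveRoot-square R ζ-primitive)
  e≡d/2 : e ≡ e * 2 / 2
  e≡d/2 = sym (m*n/n≡m e 2)
  e∣1+n : e ∣ suc n
  e∣1+n = *-cancelʳ-∣ 2 (subst (e * 2 ∣_) (2*n+2≡[1+n]*2 n) d∣2n+2)
  parts≤n : All (_≤ n) λs
  parts≤n = All.map (λ p≤t → ≤-trans p≤t t≤n) (All≤sum λs)
  entries = map (λ i → mult (suc i) λs) (upTo n)
  l≡sum-entries : length λs ≡ sum entries
  l≡sum-entries = length≡sum-mult parts≥1 parts≤n
  e∣entries : All (e ∣_) entries
  e∣entries = qmultinom≉0⇒∣ entries (trans (+-comm n (length λs)) (cong (_+ n) l≡sum-entries)) e∣1+n mu≉0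
  e∣mult : ∀ i → e ∣ mult i λs
  e∣mult = ∣entries⇒∣mult parts≥1 parts≤n e∣entries
  e∣l : e ∣ length λs
  e∣l = subst (e ∣_) (sym l≡sum-entries) (All∣⇒∣sum e∣entries)
  e∣t : e ∣ sum λs
  e∣t = subst (e ∣_) (cong sum (map-id λs)) (∣mult⇒∣sum-map (λ p → p) (All.map s≤s parts≤n) e∣mult)
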